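{- Fix a skew shape $\lambda/\mu$ and a finite sequence $h$ of positive integers. Then for each word $r$ there is at most one reverse plane partition $T$ of shape $\lambda/\mu$ with $r(T)=r$ and $h(T)=h$.
   Context: Skew shapes are drawn in matrix coordinates (row index increases downward). A reverse plane partition of shape $\lambda/\mu$ is a filling of its boxes with positive integers weakly increasing along rows and down columns. The reading word $r(T)$: ignore every entry of $T$ equal to the entry directly below it; read the remaining entries row by row from the bottom row to the top row, each row from left to right. The height vector $h(T)$ is the sequence of row indices (vertical coordinates) of the entries contributing to $r(T)$, listed in the same order as they appear in $r(T)$. -}

module Defs where

open import Data.Nat using (ℕ; zero; suc; _+_; _∸_; _≤_; _<_; _≤ᵇ_; _<ᵇ_; _≡ᵇ_)
open import Data.Bool using (Bool; true; false; _∧_; if_then_else_)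
open import Data.List using (List; []; _∷_; length; map; reverse; upTo; concatMap)
open import Data.Product using (_×_; _,_; proj₁; proj₂)

part : List ℕ → ℕ → ℕ
part []       _       = 0
part (x ∷ xs) zero    = x
part (x ∷ xs) (suc i) = part xs i

IsPartition : List ℕ → Set
IsPartition p = ∀ i → part p (suc i) ≤ part p i

record SkewShape : Set where
  constructor _/_⟨_,_,_⟩
  field
    outer : List ℕ
    inner : List ℕ
    outer-partition : IsPartition outer
    inner-partition : IsPartition inner
    inner⊆outer : ∀ i → part inner i ≤ part outer i
open SkewShape public

-- box (i , j) (row i, column j, both 0-indexed, matrix coordinates) lies in λ/μ
InShape : SkewShape → ℕ → ℕ → Set
InShape sh i j = (part (inner sh) i ≤ j) × (j < part (outer sh) i)

inShapeᵇ : SkewShape → ℕ → ℕ → Bool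
inShapeᵇ sh i j = (part (inner sh) i ≤ᵇ j) ∧ (j <ᵇ part (outer sh) i)

-- a filling is a function on boxes (values outside the shape are irrelevant)
Filling : Set
Filling = ℕ → ℕ → ℕ

record IsRPP (sh : SkewShape) (T : Filling) : Set where
  field
    positive : ∀ i j → InShape sh i j → 1 ≤ T i j
    rows     : ∀ i j → InShape sh i j → InShape sh i (suc j) → T i j ≤ T i (suc j)
    columns  : ∀ i j → InShape sh i j → InShape sh (suc i) j → T i j ≤ T (suc i) j

ignoredᵇ : SkewShape → Filling → ℕ → ℕ → Bool
ignoredᵇ sh T i j = inShapeᵇ sh (suc i) j ∧ (T i j ≡ᵇ T (suc i) j)

-- pairs (entry , row index), rows reported 1-indexed (top row = 1)
rowPairs : SkewShape → Filling → ℕ → List ℕ → List (ℕ × ℕ)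
rowPairs sh T i []       = []
rowPairs sh T i (j ∷ js) =
  if ignoredᵇ sh T i j then rowPairs sh T i js
  else (T i j , suc i) ∷ rowPairs sh T i js

rowColumns : SkewShape → ℕ → List ℕ
rowColumns sh i = map (part (inner sh) i +_) (upTo (part (outer sh) i ∸ part (inner sh) i))

readingPairs : SkewShape → Filling → List (ℕ × ℕ)
readingPairs sh T =
  concatMap (λ i → rowPairs sh T i (rowColumns sh i)) (reverse (upTo (length (outer sh))))

readingWord : SkewShape → Filling → List ℕ
readingWord sh T = map proj₁ (readingPairs sh T)

heightVector : SkewShape → Filling → List ℕ
heightVector sh T = map proj₂ (readingPairs sh T)

-- Since the height vector records the row of every letter of the reading
-- word, the two data together determine, row by row, the list of (entry, row)
-- pairs that each row contributes.  Rows are then reconstructed from the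
-- bottom up: once row i+1 is known, row i is recovered from its contribution
-- by scanning it left to right.  The only thing to rule out is that one
-- filling skips a box (its entry equals the entry below) while the other
-- records it.  If T skips box (i,c) and T′ records it, then
--   T′ i c < T′ (i+1) c = T (i+1) c = T i c        (column monotonicity),
-- while the next recorded entry of T lies weakly right of c in row i, hence
-- is ≥ T i c by row monotonicity; so the two contributions would start with
-- different letters.
module Submission where

open import Defs
open import Data.Nat using (ℕ; _≤_)
open import Data.List using (List)
open import Data.List.Relation.Unary.All using (All)
open import Relation.Binary.PropositionalEquality using (_≡_)

open import Data.Nat using (suc; _+_; _∸_; _<_; s≤s; _≤′_; ≤′-reflexive; ≤′-step; _≤?_)
open import Data.Nat.Properties
open import Data.Bool using (T; true; false)
open import Data.Bool.Properties using (T-≡; T-∧)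
open import Data.Empty using (⊥; ⊥-elim)
open import Data.List using ([]; _∷_; _++_; length; map; reverse; upTo; concatMap)
open import Data.List.Properties using (∷-injective; upTo-∷ʳ; reverse-++)
open import Data.List.Membership.Propositional using (_∈_)
open import Data.List.Membership.Propositional.Properties using (∈-map⁺; ∈-upTo⁺)
open import Data.List.Relation.Unary.All using ([]; _∷_)
import Data.List.Relation.Unary.All as All
open import Data.List.Relation.Unary.All.Properties using (++⁺; all-upTo)
import Data.List.Relation.Unary.All.Properties as AllP
open import Data.List.Relation.Unary.AllPairs using (AllPairs; []; _∷_)
import Data.List.Relation.Unary.AllPairs.Properties as AllPairsP
open import Data.Product using (_×_; _,_; proj₁; proj₂)
open import Data.Sum using (inj₁; inj₂)
open import Function.Bundles using (Equivalence)
open import Relation.Nullary using (¬_; yes; no)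
open import Relation.Binary.PropositionalEquality using (refl; sym; trans; cong; subst)

-- A list of pairs is determined by its two lists of components; this turns
-- "same reading word and same height vector" into "same reading pairs".
pairs-from-projections : {A B : Set} (xs ys : List (A × B))
  → map proj₁ xs ≡ map proj₁ ys → map proj₂ xs ≡ map proj₂ ys → xs ≡ ys
pairs-from-projections []             []             _  _  = refl
pairs-from-projections ((a , b) ∷ xs) ((c , d) ∷ ys) e₁ e₂
  with ∷-injective e₁ | ∷-injective e₂
... | refl , e₁′ | refl , e₂′ = cong ((a , b) ∷_) (pairs-from-projections xs ys e₁′ e₂′)

++-split-by-tags : {A : Set} {P Q : A → Set} → (∀ {x} → P x → Q x → ⊥)
  → {xs xs′ ys ys′ : List A} → All P xs → All P xs′ → All Q ys → All Q ys′
  → xs ++ ys ≡ xs′ ++ ys′ → xs ≡ xs′ × ys ≡ ys′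
++-split-by-tags apart [] [] _ _ e = refl , e
++-split-by-tags apart [] (p ∷ _) (q ∷ _) _ e with ∷-injective e
... | refl , _ = ⊥-elim (apart p q)
++-split-by-tags apart (p ∷ _) [] _ (q ∷ _) e with ∷-injective e
... | refl , _ = ⊥-elim (apart p q)
++-split-by-tags apart (_ ∷ ps) (_ ∷ ps′) qs qs′ e with ∷-injective e
... | refl , e′ with ++-split-by-tags apart ps ps′ qs qs′ e′
...   | refl , e″ = refl , e″

downward-induction : (P : ℕ → Set) (L : ℕ)
  → (∀ i → L ≤ i → P i) → (∀ i → i < L → P (suc i) → P i) → ∀ i → P i
downward-induction P L base step i = go L i (m≤n+m L i)
  where
  go : ∀ d i → L ≤ i + d → P i
  go 0       i L≤i = base i (subst (L ≤_) (+-identityʳ i) L≤i)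
  go (suc d) i L≤i+d with L ≤? i
  ... | yes L≤i = base i L≤i
  ... | no  L≰i = step i (≰⇒> L≰i) (go d (suc i) (subst (L ≤_) (+-suc i d) L≤i+d))

inShapeᵇ-sound : ∀ sh i j → T (inShapeᵇ sh i j) → InShape sh i j
inShapeᵇ-sound sh i j t with Equivalence.to T-∧ t
... | t₁ , t₂ = ≤ᵇ⇒≤ _ _ t₁ , <ᵇ⇒< _ _ t₂

inShapeᵇ-complete : ∀ sh i j → InShape sh i j → T (inShapeᵇ sh i j)
inShapeᵇ-complete sh i j (μ≤j , j<λ) = Equivalence.from T-∧ (≤⇒≤ᵇ μ≤j , <⇒<ᵇ j<λ)

ignored-sound : ∀ sh F i j → ignoredᵇ sh F i j ≡ true
  → InShape sh (suc i) j × F i j ≡ F (suc i) j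
ignored-sound sh F i j e with Equivalence.to T-∧ (Equivalence.from T-≡ e)
... | below , equal = inShapeᵇ-sound sh (suc i) j below , ≡ᵇ⇒≡ _ _ equal

ignored-complete : ∀ sh F i j → ignoredᵇ sh F i j ≡ false
  → InShape sh (suc i) j → ¬ F i j ≡ F (suc i) j
ignored-complete sh F i j e below equal
  with trans (sym e) (Equivalence.to T-≡
         (Equivalence.from T-∧ (inShapeᵇ-complete sh (suc i) j below , ≡⇒≡ᵇ _ _ equal)))
... | ()

-- The contribution of a row is a sublist of its (entry, row) pairs, so any
-- property of all those pairs holds for all recorded pairs.
rowPairs-All : ∀ sh F i (P : ℕ × ℕ → Set) cs
  → All (λ j → P (F i j , suc i)) cs → All P (rowPairs sh F i cs)
rowPairs-All sh F i P []       []       = []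
rowPairs-All sh F i P (c ∷ cs) (p ∷ ps) with ignoredᵇ sh F i c
... | true  = rowPairs-All sh F i P cs ps
... | false = p ∷ rowPairs-All sh F i P cs ps

rowPairs-heights : ∀ sh F i cs → All (λ p → proj₂ p ≡ suc i) (rowPairs sh F i cs)
rowPairs-heights sh F i cs = rowPairs-All sh F i _ cs (All.universal (λ _ → refl) cs)

AgreeOnRow : SkewShape → Filling → Filling → ℕ → Set
AgreeOnRow sh F G i = ∀ j → InShape sh i j → F i j ≡ G i j

AgreeOnRow-sym : ∀ {sh F G i} → AgreeOnRow sh F G i → AgreeOnRow sh G F i
AgreeOnRow-sym agree j inS = sym (agree j inS)

part-beyond : ∀ p i → length p ≤ i → part p i ≡ 0
part-beyond []      i       _         = refl
part-beyond (x ∷ p) (suc i) (s≤s l≤i) = part-beyond p i l≤i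

agree-beyond : ∀ sh F G i → length (outer sh) ≤ i → AgreeOnRow sh F G i
agree-beyond sh F G i l≤i j (_ , j<λ) =
  ⊥-elim (n≮0 (subst (j <_) (part-beyond (outer sh) i l≤i) j<λ))

module RowMonotone {sh : SkewShape} {F : Filling} (RF : IsRPP sh F) where
  open IsRPP RF

  -- Rows of a reverse plane partition are weakly increasing between any two
  -- boxes, not only neighbouring ones (the shape is convex along rows).
  row-monotone′ : ∀ i {a k} → a ≤′ k → InShape sh i a → InShape sh i k → F i a ≤ F i k
  row-monotone′ i (≤′-reflexive refl) inA inK = ≤-refl
  row-monotone′ i {k = suc k} (≤′-step a≤′k) inA inK =
    ≤-trans (row-monotone′ i a≤′k inA inK′) (rows i _ inK′ inK)
    where
    inK′ : InShape sh i k
    inK′ = ≤-trans (proj₁ inA) (≤′⇒≤ a≤′k) , <-trans (n<1+n _) (proj₂ inK)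

  row-monotone : ∀ i {a k} → a ≤ k → InShape sh i a → InShape sh i k → F i a ≤ F i k
  row-monotone i a≤k = row-monotone′ i (≤⇒≤′ a≤k)

module RowReconstruction {sh : SkewShape} {F G : Filling}
  (RF : IsRPP sh F) (RG : IsRPP sh G) (i : ℕ) (agree : AgreeOnRow sh F G (suc i)) where

  -- If F skips box (i,c) and G records it, then G i c < F i c, because the
  -- entry below is the same in both fillings.
  skipped-entry-larger : ∀ c → InShape sh i c
    → ignoredᵇ sh F i c ≡ true → ignoredᵇ sh G i c ≡ false → G i c < F i c
  skipped-entry-larger c inC eF eG with ignored-sound sh F i c eF
  ... | below , F≡F↓ =
    subst (G i c <_) (sym (trans F≡F↓ (agree c below)))
      (≤∧≢⇒< (IsRPP.columns RG i c inC below) (ignored-complete sh G i c eG below))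

  -- Hence this situation cannot occur when the contributions are equal: all
  -- letters F still records lie weakly right of c, so they are ≥ F i c.
  skip-mismatch : ∀ c cs → InShape sh i c → All (InShape sh i) cs → All (c ≤_) cs
    → ignoredᵇ sh F i c ≡ true → ignoredᵇ sh G i c ≡ false
    → ∀ xs → ¬ rowPairs sh F i cs ≡ (G i c , suc i) ∷ xs
  skip-mismatch c cs inC inCs c≤cs eF eG xs eq
    with subst (All (λ p → F i c ≤ proj₁ p)) eq
           (rowPairs-All sh F i _ cs
             (All.zipWith (λ (inK , c≤k) → RowMonotone.row-monotone RF i c≤k inC inK)
               (inCs , c≤cs)))
  ... | F≤G ∷ _ = <⇒≱ (skipped-entry-larger c inC eF eG) F≤G

row-determined : ∀ {sh F G} (RF : IsRPP sh F) (RG : IsRPP sh G) i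
  → AgreeOnRow sh F G (suc i) → ∀ cs → All (InShape sh i) cs → AllPairs _≤_ cs
  → rowPairs sh F i cs ≡ rowPairs sh G i cs → All (λ j → F i j ≡ G i j) cs
row-determined RF RG i agree [] [] [] eq = []
row-determined {sh} {F} {G} RF RG i agree (c ∷ cs) (inC ∷ inCs) (c≤cs ∷ sorted) eq
  with ignoredᵇ sh F i c in eF | ignoredᵇ sh G i c in eG
... | true  | true  =
  both-skipped ∷ row-determined RF RG i agree cs inCs sorted eq
  where
  -- both entries equal the common entry below them
  both-skipped : F i c ≡ G i c
  both-skipped with ignored-sound sh F i c eF | ignored-sound sh G i c eG
  ... | below , F≡F↓ | _ , G≡G↓ = trans F≡F↓ (trans (agree c below) (sym G≡G↓))
... | false | false =
  cong proj₁ (proj₁ (∷-injective eq))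
    ∷ row-determined RF RG i agree cs inCs sorted (proj₂ (∷-injective eq))
... | true  | false =
  ⊥-elim (RowReconstruction.skip-mismatch RF RG i agree c cs inC inCs c≤cs eF eG _ eq)
... | false | true  =
  ⊥-elim (RowReconstruction.skip-mismatch RG RF i (AgreeOnRow-sym {sh} {F} {G} agree)
            c cs inC inCs c≤cs eG eF _ (sym eq))

module RowColumns (sh : SkewShape) (i : ℕ) where
  private
    μ = part (inner sh) i
    n = part (outer sh) i ∸ μ

    μ+n≡λ : μ + n ≡ part (outer sh) i
    μ+n≡λ = m+[n∸m]≡n (inner⊆outer sh i)

  rowColumns-inShape : All (InShape sh i) (rowColumns sh i)
  rowColumns-inShape = AllP.map⁺ (All.map (λ k<n →
    m≤m+n μ _ , subst (μ + _ <_) μ+n≡λ (+-monoʳ-< μ k<n)) (all-upTo n))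

  rowColumns-sorted : AllPairs _≤_ (rowColumns sh i)
  rowColumns-sorted = AllPairsP.map⁺
    (AllPairsP.applyUpTo⁺₁ (λ k → k) n (λ k<l _ → +-monoʳ-≤ μ (<⇒≤ k<l)))

  rowColumns-complete : ∀ j → InShape sh i j → j ∈ rowColumns sh i
  rowColumns-complete j (μ≤j , j<λ) =
    subst (_∈ rowColumns sh i) (m+[n∸m]≡n μ≤j)
      (∈-map⁺ (μ +_) (∈-upTo⁺ (∸-monoˡ-< j<λ μ≤j)))

rowContribution : SkewShape → Filling → ℕ → List (ℕ × ℕ)
rowContribution sh F i = rowPairs sh F i (rowColumns sh i)

row-agree : ∀ {sh F G} → IsRPP sh F → IsRPP sh G → ∀ i
  → AgreeOnRow sh F G (suc i) → rowContribution sh F i ≡ rowContribution sh G i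
  → AgreeOnRow sh F G i
row-agree {sh} RF RG i agree eq j inS =
  All.lookup (row-determined RF RG i agree (rowColumns sh i)
                rowColumns-inShape rowColumns-sorted eq)
             (rowColumns-complete j inS)
  where open RowColumns sh i

topRowsPairs : SkewShape → Filling → ℕ → List (ℕ × ℕ)
topRowsPairs sh F n = concatMap (rowContribution sh F) (reverse (upTo n))

topRowsPairs-suc : ∀ sh F n
  → topRowsPairs sh F (suc n) ≡ rowContribution sh F n ++ topRowsPairs sh F n
topRowsPairs-suc sh F n = cong (concatMap (rowContribution sh F))
  (trans (cong reverse (sym (upTo-∷ʳ n))) (reverse-++ (upTo n) (n ∷ [])))

topRowsPairs-heights : ∀ sh F n → All (λ p → proj₂ p ≤ n) (topRowsPairs sh F n)
topRowsPairs-heights sh F 0       = []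
topRowsPairs-heights sh F (suc n) =
  subst (All (λ p → proj₂ p ≤ suc n)) (sym (topRowsPairs-suc sh F n))
    (++⁺ (All.map ≤-reflexive (rowPairs-heights sh F n (rowColumns sh n)))
         (All.map (λ h≤n → ≤-trans h≤n (n≤1+n n)) (topRowsPairs-heights sh F n)))

-- Since the heights separate the rows, equal reading pairs of the top n rows
-- force equal contributions of every one of these rows.
rows-from-reading : ∀ sh F G n → topRowsPairs sh F n ≡ topRowsPairs sh G n
  → ∀ i → i < n → rowContribution sh F i ≡ rowContribution sh G i
rows-from-reading sh F G (suc n) eq i i<1+n
  with ++-split-by-tags (λ h≡1+n h≤n → 1+n≰n (subst (_≤ n) h≡1+n h≤n))
         (rowPairs-heights sh F n (rowColumns sh n)) (rowPairs-heights sh G n (rowColumns sh n))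
         (topRowsPairs-heights sh F n) (topRowsPairs-heights sh G n)
         (trans (sym (topRowsPairs-suc sh F n)) (trans eq (topRowsPairs-suc sh G n)))
... | same-row , same-top with m≤n⇒m<n∨m≡n (≤-pred i<1+n)
...   | inj₂ refl = same-row
...   | inj₁ i<n  = rows-from-reading sh F G n same-top i i<n

lemma2p1 : (sh : SkewShape) (h : List ℕ) → All (1 ≤_) h → (r : List ℕ)
    → (T T′ : Filling) → IsRPP sh T → IsRPP sh T′
    → readingWord sh T ≡ r → heightVector sh T ≡ h
    → readingWord sh T′ ≡ r → heightVector sh T′ ≡ h
    → ∀ i j → InShape sh i j → T i j ≡ T′ i j
lemma2p1 sh h _ r F G RF RG wordF heightsF wordG heightsG =
  downward-induction (AgreeOnRow sh F G) (length (outer sh))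
    (agree-beyond sh F G)
    (λ i i<ℓ agreeBelow → row-agree RF RG i agreeBelow (sameRows i i<ℓ))
  where
  sameReading : readingPairs sh F ≡ readingPairs sh G
  sameReading = pairs-from-projections _ _
    (trans wordF (sym wordG)) (trans heightsF (sym heightsG))

  sameRows : ∀ i → i < length (outer sh) → rowContribution sh F i ≡ rowContribution sh G i
  sameRows = rows-from-reading sh F G (length (outer sh)) sameReading
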